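{- Suppose $P_3(\mathbf{x})=0$, where $P_3(\mathbf{x})=\sum_{i=0}^{n_{\mathcal{T}}-1}\sum_{\text{tree }v_j}\big(x_{i,j_1}x_{i,j_2}-2x_{i,j_1}z_{i,j}-2x_{i,j_2}z_{i,j}+3z_{i,j}\big)$. Let $P_4(\mathbf{x})=\sum_{i=0}^{n_{\mathcal{T}}-1}\sum_{\text{tree }v_j}x_{i,j}z_{i,j}$. Then $P_4(\mathbf{x})=0$ if and only if there do not exist a tree vertex $v_j$ of $\mathcal{N}$ and a vertex $u_i\in V(\mathcal{T})$ such that $\{v_j,v_{j_1},v_{j_2}\}\subseteq d(\mathbf{x},u_i)$.
   Context: $\mathcal{N}$ is a rooted binary phylogenetic network on a finite set $X$ with vertices $v_0,\dots,v_{n_{\mathcal{N}}-1}$, and $\mathcal{T}$ is a rooted binary phylogenetic $X$-tree with vertices $u_0,\dots,u_{n_{\mathcal{T}}-1}$. A tree vertex is a vertex of out-degree 2, and its two children are $v_{j_1}$ and $v_{j_2}$ (in a fixed order). Sums over "tree $v_j$" range over indices $j$ with $v_j$ a tree vertex. The variables $x_{i,j}$ and $z_{i,j}$ are binary, and $\mathbf{x}$ is the vector of them. $d(\mathbf{x},u_i)=\{v_j: x_{i,j}=1\}$. -}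

module Defs where

open import Data.Nat using (ℕ; zero; suc)
open import Data.Fin using (Fin)
open import Data.Fin.Properties using () renaming (_≟_ to _≟ᶠ_)
open import Data.List using (List; []; _∷_; length; foldr; map; filter)
open import Data.List.Relation.Unary.Unique.Propositional using (Unique)
open import Data.Bool using (Bool; true; false; if_then_else_)
open import Data.Integer using (ℤ; _+_; _*_; -_) renaming (+_ to ⁺)
open import Data.Product using (Σ; ∃; _×_; _,_)
open import Data.Sum using (_⊎_)
open import Data.Empty using (⊥)
open import Function using (Injective)
open import Relation.Binary.PropositionalEquality using (_≡_)
open import Relation.Nullary using (¬_)
open import Data.List using (allFin)
open import Data.List.Membership.Propositional using (_∈_)
import Data.Nat

-- Directed graphs on vertices v_0 … v_{n-1}, given by ordered child lists.
-- The out-neighbours of v are the entries of  ch v  (in a fixed order).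

module _ {n : ℕ} (ch : Fin n → List (Fin n)) where

  outdeg : Fin n → ℕ
  outdeg v = length (ch v)

  indeg : Fin n → ℕ
  indeg v = foldr (λ u acc → length (filter (_≟ᶠ v) (ch u)) Data.Nat.+ acc) 0 (allFin n)

  data Path⁺ : Fin n → Fin n → Set where
    step : ∀ {u w} → w ∈ ch u → Path⁺ u w
    cons : ∀ {u v w} → v ∈ ch u → Path⁺ v w → Path⁺ u w

  IsTreeVertex : Fin n → Fin n → Fin n → Set
  IsTreeVertex v j₁ j₂ = ch v ≡ j₁ ∷ j₂ ∷ []



record BinaryPhyloNetwork (m : ℕ) : Set where
  field
    n      : ℕ
    ch     : Fin n → List (Fin n)
    root   : Fin n
    label  : Fin m → Fin n
    simple : ∀ v → Unique (ch v)
    acyclic : ∀ v → ¬ Path⁺ ch v v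
    rootIn  : indeg ch root ≡ 0
    rootOut : outdeg ch root ≡ 0 ⊎ outdeg ch root ≡ 1 ⊎ outdeg ch root ≡ 2
    degrees : ∀ v → ¬ (v ≡ root) →
                (indeg ch v ≡ 1 × outdeg ch v ≡ 2)
              ⊎ (indeg ch v ≡ 2 × outdeg ch v ≡ 1)
              ⊎ (indeg ch v ≡ 1 × outdeg ch v ≡ 0)
    labelInj  : Injective _≡_ _≡_ label
    labelLeaf : ∀ v → (outdeg ch v ≡ 0) → ∃ λ x → label x ≡ v
    leafLabel : ∀ x → outdeg ch (label x) ≡ 0

record BinaryPhyloTree (m : ℕ) : Set where
  field
    net    : BinaryPhyloNetwork m
    noRet  : ∀ v → Data.Nat._≤_ (indeg (BinaryPhyloNetwork.ch net) v) 1

sumℤ : List ℤ → ℤ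
sumℤ = foldr _+_ (⁺ 0)

⟦_⟧ : Bool → ℤ
⟦ b ⟧ = if b then ⁺ 1 else ⁺ 0

module _ {n : ℕ} (ch : Fin n → List (Fin n)) where

  treeTerm : (Fin n → Fin n → Fin n → ℤ) → Fin n → ℤ
  treeTerm f j with ch j
  ... | j₁ ∷ j₂ ∷ [] = f j j₁ j₂
  ... | _            = ⁺ 0

  sumTree : (Fin n → Fin n → Fin n → ℤ) → ℤ
  sumTree f = sumℤ (map (treeTerm f) (allFin n))

sumFin : (k : ℕ) → (Fin k → ℤ) → ℤ
sumFin k g = sumℤ (map g (allFin k))

module _ {m : ℕ} (N : BinaryPhyloNetwork m) (T : BinaryPhyloTree m) where
  open BinaryPhyloNetwork N
  nT : ℕ
  nT = BinaryPhyloNetwork.n (BinaryPhyloTree.net T)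

  P₃ : (x z : Fin nT → Fin n → Bool) → ℤ
  P₃ x z = sumFin nT λ i → sumTree ch λ j j₁ j₂ →
      ⟦ x i j₁ ⟧ * ⟦ x i j₂ ⟧
    + (- (⁺ 2 * ⟦ x i j₁ ⟧ * ⟦ z i j ⟧))
    + (- (⁺ 2 * ⟦ x i j₂ ⟧ * ⟦ z i j ⟧))
    + ⁺ 3 * ⟦ z i j ⟧

  P₄ : (x z : Fin nT → Fin n → Bool) → ℤ
  P₄ x z = sumFin nT λ i → sumTree ch λ j j₁ j₂ → ⟦ x i j ⟧ * ⟦ z i j ⟧

  _∈d[_,_] : Fin n → (Fin nT → Fin n → Bool) → Fin nT → Set
  v ∈d[ x , i ] = x i v ≡ true

-- Every summand of P₃ is non-negative on 0/1 values and vanishes exactly when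
-- z_{i,j} = x_{i,j₁} x_{i,j₂}; so P₃ = 0 forces that identity for all i and all
-- tree vertices v_j. Then every summand x_{i,j} z_{i,j} = x_{i,j} x_{i,j₁} x_{i,j₂}
-- of P₄ is non-negative as well, and P₄ = 0 iff each of them vanishes, i.e. iff
-- no d(x, u_i) contains all of v_j, v_{j₁}, v_{j₂}.
module Submission where

open import Defs
open import Data.Nat using (ℕ; z≤n)
open import Data.Fin using (Fin)
open import Data.Bool using (Bool; true; false; _∧_)
open import Data.Integer using (ℤ; 0ℤ; _≤_; _+_; _*_; -_; +≤+; nonNegative) renaming (+_ to ⁺)
open import Data.Integer.Properties using (≤-antisym; +-mono-≤; i≤i+j; i≤j+i)
open import Data.List using (List; []; _∷_; map; allFin)
open import Data.List.Relation.Unary.All using (All; []; _∷_)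
open import Data.List.Relation.Unary.All.Properties using (tabulate⁺; tabulate⁻)
open import Data.Product using (Σ; _×_; _,_)
open import Data.Empty using (⊥-elim)
open import Function using (_∘_)
open import Function.Bundles using (_⇔_; mk⇔; Equivalence)
open import Relation.Binary.PropositionalEquality using (_≡_; refl; sym; subst)
open import Relation.Nullary using (¬_)

open Equivalence using (to; from)

+-nonNeg≡0 : ∀ {i j} → 0ℤ ≤ i → 0ℤ ≤ j → i + j ≡ 0ℤ → i ≡ 0ℤ × j ≡ 0ℤ
+-nonNeg≡0 {i} {j} 0≤i 0≤j i+j≡0 =
    ≤-antisym (subst (i ≤_) i+j≡0 (i≤i+j i j {{nonNegative 0≤j}})) 0≤i
  , ≤-antisym (subst (j ≤_) i+j≡0 (i≤j+i j i {{nonNegative 0≤i}})) 0≤j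

module _ {A : Set} {f : A → ℤ} (f≥0 : ∀ a → 0ℤ ≤ f a) where

  sumℤ-map-nonNeg : ∀ xs → 0ℤ ≤ sumℤ (map f xs)
  sumℤ-map-nonNeg []       = +≤+ z≤n
  sumℤ-map-nonNeg (a ∷ xs) = +-mono-≤ (f≥0 a) (sumℤ-map-nonNeg xs)

  sumℤ-map≡0⇔All≡0 : ∀ xs → sumℤ (map f xs) ≡ 0ℤ ⇔ All (λ a → f a ≡ 0ℤ) xs
  sumℤ-map≡0⇔All≡0 xs = mk⇔ (⇒ xs) (⇐ xs)
    where
    ⇒ : ∀ xs → sumℤ (map f xs) ≡ 0ℤ → All (λ a → f a ≡ 0ℤ) xs
    ⇒ []       _  = []
    ⇒ (a ∷ xs) eq with +-nonNeg≡0 (f≥0 a) (sumℤ-map-nonNeg xs) eq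
    ... | fa≡0 , rest≡0 = fa≡0 ∷ ⇒ xs rest≡0
    ⇐ : ∀ xs → All (λ a → f a ≡ 0ℤ) xs → sumℤ (map f xs) ≡ 0ℤ
    ⇐ []       []            = refl
    ⇐ (a ∷ xs) (fa≡0 ∷ rest) rewrite fa≡0 | ⇐ xs rest = refl

module _ {k : ℕ} {g : Fin k → ℤ} (g≥0 : ∀ i → 0ℤ ≤ g i) where

  sumFin-nonNeg : 0ℤ ≤ sumFin k g
  sumFin-nonNeg = sumℤ-map-nonNeg g≥0 (allFin k)

  sumFin≡0⇔ : sumFin k g ≡ 0ℤ ⇔ (∀ i → g i ≡ 0ℤ)
  sumFin≡0⇔ = mk⇔ (tabulate⁻ ∘ to eq) (from eq ∘ tabulate⁺)
    where
    eq : sumFin k g ≡ 0ℤ ⇔ All (λ i → g i ≡ 0ℤ) (allFin k)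
    eq = sumℤ-map≡0⇔All≡0 g≥0 (allFin k)

module _ {n : ℕ} (ch : Fin n → List (Fin n)) {f : Fin n → Fin n → Fin n → ℤ}
         (f≥0 : ∀ j j₁ j₂ → 0ℤ ≤ f j j₁ j₂) where

  treeTerm-nonNeg : ∀ j → 0ℤ ≤ treeTerm ch f j
  treeTerm-nonNeg j with ch j
  ... | []            = +≤+ z≤n
  ... | _ ∷ []        = +≤+ z≤n
  ... | j₁ ∷ j₂ ∷ []  = f≥0 j j₁ j₂
  ... | _ ∷ _ ∷ _ ∷ _ = +≤+ z≤n

  treeTerm≡0⇔ : ∀ j → treeTerm ch f j ≡ 0ℤ ⇔
                  (∀ j₁ j₂ → IsTreeVertex ch j j₁ j₂ → f j j₁ j₂ ≡ 0ℤ)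
  treeTerm≡0⇔ j with ch j
  ... | []            = mk⇔ (λ _ _ _ ()) (λ _ → refl)
  ... | _ ∷ []        = mk⇔ (λ _ _ _ ()) (λ _ → refl)
  ... | j₁ ∷ j₂ ∷ []  = mk⇔ (λ { eq _ _ refl → eq }) (λ h → h j₁ j₂ refl)
  ... | _ ∷ _ ∷ _ ∷ _ = mk⇔ (λ _ _ _ ()) (λ _ → refl)

  sumTree-nonNeg : 0ℤ ≤ sumTree ch f
  sumTree-nonNeg = sumFin-nonNeg treeTerm-nonNeg

  sumTree≡0⇔ : sumTree ch f ≡ 0ℤ ⇔
                (∀ j j₁ j₂ → IsTreeVertex ch j j₁ j₂ → f j j₁ j₂ ≡ 0ℤ)
  sumTree≡0⇔ = mk⇔ (λ eq j → to (treeTerm≡0⇔ j) (to (sumFin≡0⇔ treeTerm-nonNeg) eq j))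
                   (λ h → from (sumFin≡0⇔ treeTerm-nonNeg) (λ j → from (treeTerm≡0⇔ j) (h j)))

sumFin-sumTree≡0⇔ : ∀ {k n} (ch : Fin n → List (Fin n)) {f : Fin k → Fin n → Fin n → Fin n → ℤ} →
  (∀ i j j₁ j₂ → 0ℤ ≤ f i j j₁ j₂) →
  sumFin k (λ i → sumTree ch (f i)) ≡ 0ℤ ⇔
  (∀ i j j₁ j₂ → IsTreeVertex ch j j₁ j₂ → f i j j₁ j₂ ≡ 0ℤ)
sumFin-sumTree≡0⇔ {k} ch {f} f≥0 =
  mk⇔ (λ eq i → to (sumTree≡0⇔ ch (f≥0 i)) (to outer eq i))
      (λ h → from outer (λ i → from (sumTree≡0⇔ ch (f≥0 i)) (h i)))
  where
  outer : sumFin k (λ i → sumTree ch (f i)) ≡ 0ℤ ⇔ (∀ i → sumTree ch (f i) ≡ 0ℤ)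
  outer = sumFin≡0⇔ (λ i → sumTree-nonNeg ch (f≥0 i))

P₃-summand : Bool → Bool → Bool → ℤ
P₃-summand a b c =
  ⟦ a ⟧ * ⟦ b ⟧ + (- (⁺ 2 * ⟦ a ⟧ * ⟦ c ⟧)) + (- (⁺ 2 * ⟦ b ⟧ * ⟦ c ⟧)) + ⁺ 3 * ⟦ c ⟧

P₃-summand-nonNeg : ∀ a b c → 0ℤ ≤ P₃-summand a b c
P₃-summand-nonNeg true  true  true  = +≤+ z≤n
P₃-summand-nonNeg true  true  false = +≤+ z≤n
P₃-summand-nonNeg true  false true  = +≤+ z≤n
P₃-summand-nonNeg true  false false = +≤+ z≤n
P₃-summand-nonNeg false true  true  = +≤+ z≤n
P₃-summand-nonNeg false true  false = +≤+ z≤n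
P₃-summand-nonNeg false false true  = +≤+ z≤n
P₃-summand-nonNeg false false false = +≤+ z≤n

P₃-summand≡0⇒≡∧ : ∀ a b c → P₃-summand a b c ≡ 0ℤ → c ≡ a ∧ b
P₃-summand≡0⇒≡∧ true  true  true  _ = refl
P₃-summand≡0⇒≡∧ true  false false _ = refl
P₃-summand≡0⇒≡∧ false true  false _ = refl
P₃-summand≡0⇒≡∧ false false false _ = refl
P₃-summand≡0⇒≡∧ true  true  false ()
P₃-summand≡0⇒≡∧ true  false true  ()
P₃-summand≡0⇒≡∧ false true  true  ()
P₃-summand≡0⇒≡∧ false false true  ()

⟦⟧*⟦⟧-nonNeg : ∀ a b → 0ℤ ≤ ⟦ a ⟧ * ⟦ b ⟧
⟦⟧*⟦⟧-nonNeg true  true  = +≤+ z≤n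
⟦⟧*⟦⟧-nonNeg true  false = +≤+ z≤n
⟦⟧*⟦⟧-nonNeg false _     = +≤+ z≤n

⟦⟧*⟦∧⟧≡0⇔ : ∀ a b c → (⟦ a ⟧ * ⟦ b ∧ c ⟧ ≡ 0ℤ) ⇔ (¬ (a ≡ true × b ≡ true × c ≡ true))
⟦⟧*⟦∧⟧≡0⇔ true  true  true  = mk⇔ (λ ()) (λ ¬abc → ⊥-elim (¬abc (refl , refl , refl)))
⟦⟧*⟦∧⟧≡0⇔ true  true  false = mk⇔ (λ { _ (_ , _ , ()) }) (λ _ → refl)
⟦⟧*⟦∧⟧≡0⇔ true  false _     = mk⇔ (λ { _ (_ , () , _) }) (λ _ → refl)
⟦⟧*⟦∧⟧≡0⇔ false _     _     = mk⇔ (λ { _ (() , _ , _) }) (λ _ → refl)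

lemma6 : {m : ℕ} (N : BinaryPhyloNetwork m) (T : BinaryPhyloTree m)
    (x z : Fin (nT N T) → Fin (BinaryPhyloNetwork.n N) → Bool) →
    P₃ N T x z ≡ ⁺ 0 →
    (P₄ N T x z ≡ ⁺ 0 ⇔
      (¬ (Σ (Fin (BinaryPhyloNetwork.n N)) λ j → Σ (Fin (BinaryPhyloNetwork.n N)) λ j₁ → Σ (Fin (BinaryPhyloNetwork.n N)) λ j₂ →
          Σ (Fin (nT N T)) λ i →
          IsTreeVertex (BinaryPhyloNetwork.ch N) j j₁ j₂
          × _∈d[_,_] N T j x i × _∈d[_,_] N T j₁ x i × _∈d[_,_] N T j₂ x i)))
lemma6 N T x z P₃≡0 = mk⇔
  (λ P₄≡0 (j , j₁ , j₂ , i , tv , xj , xj₁ , xj₂) →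
     to (P₄-summand≡0⇔ i j j₁ j₂ tv) (to P₄≡0⇔ P₄≡0 i j j₁ j₂ tv) (xj , xj₁ , xj₂))
  (λ ¬triple → from P₄≡0⇔ λ i j j₁ j₂ tv →
     from (P₄-summand≡0⇔ i j j₁ j₂ tv) λ (xj , xj₁ , xj₂) →
       ¬triple (j , j₁ , j₂ , i , tv , xj , xj₁ , xj₂))
  where
  open BinaryPhyloNetwork N using (ch)
  P₄≡0⇔ : P₄ N T x z ≡ 0ℤ ⇔
    (∀ i j j₁ j₂ → IsTreeVertex ch j j₁ j₂ → ⟦ x i j ⟧ * ⟦ z i j ⟧ ≡ 0ℤ)
  P₄≡0⇔ = sumFin-sumTree≡0⇔ ch (λ i j _ _ → ⟦⟧*⟦⟧-nonNeg (x i j) (z i j))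
  z≡x∧x : ∀ i j j₁ j₂ → IsTreeVertex ch j j₁ j₂ → z i j ≡ x i j₁ ∧ x i j₂
  z≡x∧x i j j₁ j₂ tv = P₃-summand≡0⇒≡∧ (x i j₁) (x i j₂) (z i j)
    (to (sumFin-sumTree≡0⇔ ch (λ i j j₁ j₂ → P₃-summand-nonNeg (x i j₁) (x i j₂) (z i j)))
        P₃≡0 i j j₁ j₂ tv)
  P₄-summand≡0⇔ : ∀ i j j₁ j₂ → IsTreeVertex ch j j₁ j₂ →
    (⟦ x i j ⟧ * ⟦ z i j ⟧ ≡ 0ℤ) ⇔ (¬ (x i j ≡ true × x i j₁ ≡ true × x i j₂ ≡ true))
  P₄-summand≡0⇔ i j j₁ j₂ tv =
    subst (λ c → (⟦ x i j ⟧ * ⟦ c ⟧ ≡ 0ℤ) ⇔ _) (sym (z≡x∧x i j j₁ j₂ tv))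
      (⟦⟧*⟦∧⟧≡0⇔ (x i j) (x i j₁) (x i j₂))
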